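{- Let $Q$ be a query over a $\lambda$-graph $G$. Then $Q^{\#}$ is a sharing equivalence if and only if there exists a sharing equivalence containing $Q$.
   Context: A $\lambda$-graph is a finite directed graph with application nodes $\mathrm{App}(n_1,n_2)$, abstraction nodes $\mathrm{Abs}(n)$, free variable nodes (no children) and bound variable nodes $\mathrm{Var}(l)$ with a binding edge to an abstraction node $l$, acyclic when binding edges are ignored, in which every path of child edges from a root (a node with no parents) to $\mathrm{Var}(l)$ passes through $l$. A query is a binary relation on the roots of $G$. Nodes are homogeneous if of the same kind. A sharing equivalence is an equivalence relation $R$ on the nodes which relates only homogeneous nodes, is closed under $\mathrm{App}(n_1,n_2)\,R\,\mathrm{App}(m_1,m_2)\Rightarrow n_1Rm_1$ and $n_2Rm_2$, $\mathrm{Abs}(n)\,R\,\mathrm{Abs}(m)\Rightarrow nRm$, $\mathrm{Var}(n)\,R\,\mathrm{Var}(m)\Rightarrow nRm$, and is open (two related free variable nodes are equal). $Q^{\#}$ is the closure of $Q$ under reflexivity, symmetry, transitivity and the $\mathrm{App}$ and $\mathrm{Abs}$ rules. -}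

module Defs where

open import Level using (0ℓ)
open import Data.Nat using (ℕ)
open import Data.Fin using (Fin)
open import Data.List using (List; []; _∷_)
open import Data.List.Membership.Propositional using (_∈_)
open import Data.Product using (Σ; _×_; ∃)
open import Data.Sum using (_⊎_)
open import Data.Empty using (⊥)
open import Relation.Nullary using (¬_)
open import Relation.Binary using (Rel; IsEquivalence; _⇒_)
open import Relation.Binary.PropositionalEquality using (_≡_)

data Node (n : ℕ) : Set where
  app  : Fin n → Fin n → Node n
  abs  : Fin n → Node n
  fvar : Node n
  bvar : Fin n → Node n           -- Var(l)     : binding edge to l (not a child edge)

data Kind : Set where
  kApp kAbs kFVar kBVar : Kind

kind : ∀ {n} → Node n → Kind
kind (app _ _) = kApp
kind (abs _)   = kAbs
kind fvar      = kFVar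
kind (bvar _)  = kBVar

module _ {n : ℕ} (lab : Fin n → Node n) where

  data Child : Fin n → Fin n → Set where
    appL : ∀ {x a b} → lab x ≡ app a b → Child x a
    appR : ∀ {x a b} → lab x ≡ app a b → Child x b
    absC : ∀ {x b}   → lab x ≡ abs b   → Child x b

  data Path : Fin n → Fin n → Set where
    [] : ∀ {x} → Path x x
    _∷_ : ∀ {x y z} → Child x y → Path y z → Path x z

  nodes : ∀ {x y} → Path x y → List (Fin n)
  nodes {x} []      = x ∷ []
  nodes {x} (_ ∷ p) = x ∷ nodes p

  IsRoot : Fin n → Set
  IsRoot r = ∀ m → ¬ Child m r

  BindsToAbs : Set
  BindsToAbs = ∀ v l → lab v ≡ bvar l → kind (lab l) ≡ kAbs

  AcyclicChild : Set
  AcyclicChild = ∀ {x y} → Child x y → Path y x → ⊥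

  Scoped : Set
  Scoped = ∀ r v l → IsRoot r → lab v ≡ bvar l → (p : Path r v) → l ∈ nodes p

record LambdaGraph (n : ℕ) : Set where
  field
    lab          : Fin n → Node n
    bindsToAbs   : BindsToAbs lab
    acyclic      : AcyclicChild lab
    scoped       : Scoped lab

module _ {n : ℕ} (G : LambdaGraph n) where
  open LambdaGraph G

  IsQuery : Rel (Fin n) 0ℓ → Set
  IsQuery Q = ∀ x y → Q x y → IsRoot lab x × IsRoot lab y

  Homogeneous : Fin n → Fin n → Set
  Homogeneous x y = kind (lab x) ≡ kind (lab y)

  record IsSharingEquivalence (R : Rel (Fin n) 0ℓ) : Set where
    field
      isEquivalence : IsEquivalence R
      homogeneous   : ∀ {x y} → R x y → Homogeneous x y
      appRule       : ∀ {x y n₁ n₂ m₁ m₂} → lab x ≡ app n₁ n₂ → lab y ≡ app m₁ m₂ →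
                      R x y → R n₁ m₁ × R n₂ m₂
      absRule       : ∀ {x y n₁ m₁} → lab x ≡ abs n₁ → lab y ≡ abs m₁ → R x y → R n₁ m₁
      varRule       : ∀ {x y n₁ m₁} → lab x ≡ bvar n₁ → lab y ≡ bvar m₁ → R x y → R n₁ m₁
      open-         : ∀ {x y} → lab x ≡ fvar → lab y ≡ fvar → R x y → x ≡ y

  data _♯ (Q : Rel (Fin n) 0ℓ) : Rel (Fin n) 0ℓ where
    base  : ∀ {x y} → Q x y → (Q ♯) x y
    refl♯ : ∀ {x} → (Q ♯) x x
    sym♯  : ∀ {x y} → (Q ♯) x y → (Q ♯) y x
    trans♯ : ∀ {x y z} → (Q ♯) x y → (Q ♯) y z → (Q ♯) x z
    appL♯ : ∀ {x y n₁ n₂ m₁ m₂} → lab x ≡ app n₁ n₂ → lab y ≡ app m₁ m₂ →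
            (Q ♯) x y → (Q ♯) n₁ m₁
    appR♯ : ∀ {x y n₁ n₂ m₁ m₂} → lab x ≡ app n₁ n₂ → lab y ≡ app m₁ m₂ →
            (Q ♯) x y → (Q ♯) n₂ m₂
    abs♯  : ∀ {x y n₁ m₁} → lab x ≡ abs n₁ → lab y ≡ abs m₁ →
            (Q ♯) x y → (Q ♯) n₁ m₁

module Submission where

-- (⇒) is immediate.  For (⇐) fix a sharing equivalence R ⊇ Q.  By
-- minimality Q♯ ⊆ R, which yields homogeneity and openness of Q♯; the App and
-- Abs rules hold by construction.  The only real work is the Var rule.
--
-- Nodes are addressed by access words (lists of directions left/right/body)
-- read from a node.  Three general facts are established first, in the
-- modules AccessPaths (any λ-graph) and Transport (any sharing equivalence):
--   * every node lies below a root (the child relation is well founded),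
--     so by scoping the binder of a variable reached by a word w from z is
--     either reached from z by a prefix of w or is a proper ancestor of z;
--   * a sharing equivalence transports walks and never relates a node to a
--     proper descendant; hence two R-related nodes reached from the same node
--     along prefixes of one word are reached by the same prefix;
--   * consequently, if y R z and the binder of a variable below y sits at a
--     prefix u, the R-related binder of the corresponding variable below z
--     sits at the same prefix u.
-- The Var rule then follows from an invariant proved by induction on Q♯: for
-- x Q♯ y, the binders of the variables reached from x and y by a common word
-- are either reached by a common prefix, or are themselves Q♯-related
-- (module Closure).

open import Defs
open import Level using (0ℓ)
open import Data.Nat using (ℕ)
open import Data.Fin using (Fin)
open import Data.Fin.Properties using (any?) renaming (_≟_ to _≟ᶠ_)
open import Data.Fin.Induction using (spo-wellFounded; spo-noetherian)
open import Data.Product using (Σ; _×_; _,_; proj₁; proj₂)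
open import Data.Sum using (_⊎_; inj₁; inj₂; map₁)
open import Data.Empty using (⊥; ⊥-elim)
open import Data.Maybe using (Maybe; just; nothing)
open import Data.Maybe.Properties using (just-injective) renaming (≡-dec to maybe-≡-dec)
open import Data.List using (List; []; _∷_; _++_)
open import Data.List.Properties using (∷-injective; ++-identityʳ)
open import Data.List.Membership.Propositional using (_∈_)
open import Data.List.Relation.Unary.Any using (here; there)
open import Relation.Nullary using (¬_; Dec; yes; no)
open import Relation.Binary using (Rel; _⇒_; IsEquivalence; IsStrictPartialOrder)
open import Relation.Binary.PropositionalEquality
  using (_≡_; refl; sym; trans; cong)
  renaming (isEquivalence to ≡-isEquivalence)
open import Induction.WellFounded using (Acc; acc)
open import Function.Base using (flip)
open import Function.Bundles using (_⇔_; mk⇔)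

-- Directions along child edges: left/right child of App, body of Abs.
data Dir : Set where
  dL dR dB : Dir

_≼_ : List Dir → List Dir → Set
u ≼ w = Σ (List Dir) λ v → w ≡ u ++ v

prefixes-comparable : ∀ {u₁ u₂ w} → u₁ ≼ w → u₂ ≼ w →
                      (Σ (List Dir) λ k → u₂ ≡ u₁ ++ k) ⊎ (Σ (List Dir) λ k → u₁ ≡ u₂ ++ k)
prefixes-comparable {[]}     {u₂}     _ _ = inj₁ (u₂ , refl)
prefixes-comparable {u₁}     {[]}     _ _ = inj₂ (u₁ , refl)
prefixes-comparable {d ∷ u₁} {_ ∷ u₂} (v₁ , refl) (v₂ , e) with ∷-injective e
... | refl , e′ with prefixes-comparable {u₁} {u₂} (v₁ , refl) (v₂ , e′)
...   | inj₁ (k , refl) = inj₁ (k , refl)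
...   | inj₂ (k , refl) = inj₂ (k , refl)

module AccessPaths {n : ℕ} (G : LambdaGraph n) where
  open LambdaGraph G

  step : Node n → Dir → Maybe (Fin n)
  step (app a b) dL = just a
  step (app a b) dR = just b
  step (abs b)   dB = just b
  step _         _  = nothing

  infixr 5 _▸_
  data Walk : Fin n → List Dir → Fin n → Set where
    []  : ∀ {x} → Walk x [] x
    _▸_ : ∀ {x d c w a} → step (lab x) d ≡ just c → Walk c w a → Walk x (d ∷ w) a

  walk-deterministic : ∀ {x w a b} → Walk x w a → Walk x w b → a ≡ b
  walk-deterministic [] [] = refl
  walk-deterministic (e ▸ W) (e′ ▸ W′) with just-injective (trans (sym e) e′)
  ... | refl = walk-deterministic W W′

  walk-++ : ∀ {x u v c a} → Walk x u c → Walk c v a → Walk x (u ++ v) a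
  walk-++ []      W′ = W′
  walk-++ (e ▸ W) W′ = e ▸ walk-++ W W′

  walk-++⁻ : ∀ {x v a} u → Walk x (u ++ v) a → Σ (Fin n) λ c → Walk x u c × Walk c v a
  walk-++⁻ []      W       = _ , [] , W
  walk-++⁻ (d ∷ u) (e ▸ W) with walk-++⁻ u W
  ... | c , W₁ , W₂ = c , e ▸ W₁ , W₂

  step-child : ∀ {x d c} → step (lab x) d ≡ just c → Child lab x c
  step-child {x} {d} e with lab x in ex
  step-child {d = dL} refl | app a b = appL ex
  step-child {d = dR} refl | app a b = appR ex
  step-child {d = dB} refl | abs b   = absC ex

  child-step : ∀ {x c} → Child lab x c → Σ Dir λ d → step (lab x) d ≡ just c
  child-step (appL e) = dL , cong (λ t → step t dL) e
  child-step (appR e) = dR , cong (λ t → step t dR) e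
  child-step (absC e) = dB , cong (λ t → step t dB) e

  walkPath : ∀ {x w a} → Walk x w a → Path lab x a
  walkPath []      = []
  walkPath (e ▸ W) = step-child e ∷ walkPath W

  Below : Rel (Fin n) 0ℓ
  Below x y = Σ Dir λ d → Σ (List Dir) λ k → Walk x (d ∷ k) y

  below-walk : ∀ {x y w z} → Below x y → Walk y w z → Below x z
  below-walk (d , k , W) W′ = d , k ++ _ , walk-++ W W′

  -- By acyclicity, Below is a strict order on the finitely many nodes,
  -- hence well founded in both directions.
  below-isStrictPartialOrder : IsStrictPartialOrder _≡_ Below
  below-isStrictPartialOrder = record
    { isEquivalence = ≡-isEquivalence
    ; irrefl        = λ { refl (_ , _ , e ▸ W) → acyclic (step-child e) (walkPath W) }
    ; trans         = λ { p (_ , _ , W) → below-walk p W }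
    ; <-resp-≈      = (λ { refl q → q }) , (λ { refl q → q })
    }

  root-unbelow : ∀ {r l} → IsRoot lab r → ¬ Below l r
  root-unbelow root (_ , _ , W) = no-walk-into root W
    where
    no-walk-into : ∀ {l d k r} → IsRoot lab r → ¬ Walk l (d ∷ k) r
    no-walk-into root (e ▸ [])          = root _ (step-child e)
    no-walk-into root (_ ▸ W@(_ ▸ _))   = no-walk-into root W

  parent? : ∀ m z → Dec (Σ Dir λ d → step (lab m) d ≡ just z)
  parent? m z with maybe-≡-dec _≟ᶠ_ (step (lab m) dL) (just z)
                 | maybe-≡-dec _≟ᶠ_ (step (lab m) dR) (just z)
                 | maybe-≡-dec _≟ᶠ_ (step (lab m) dB) (just z)
  ... | yes e | _     | _     = yes (dL , e)
  ... | _     | yes e | _     = yes (dR , e)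
  ... | _     | _     | yes e = yes (dB , e)
  ... | no ¬l | no ¬r | no ¬b = no λ { (dL , e) → ¬l e ; (dR , e) → ¬r e ; (dB , e) → ¬b e }

  Reachable : Fin n → Set
  Reachable z = Σ (Fin n) λ r → IsRoot lab r × Σ (List Dir) λ p → Walk r p z

  -- Every node lies below a root: climb to parents, which terminates since
  -- Below is well founded.
  everyReachable : ∀ z → Reachable z
  everyReachable z = climb (spo-wellFounded below-isStrictPartialOrder z)
    where
    climb : ∀ {z} → Acc Below z → Reachable z
    climb {z} (acc up) with any? (λ m → parent? m z)
    ... | yes (m , d , e) with climb (up (d , [] , e ▸ []))
    ...   | r , root , p , W = r , root , p ++ d ∷ [] , walk-++ W (e ▸ [])
    climb {z} (acc up) | no orphan =
      z , (λ m ch → orphan (m , child-step ch)) , [] , []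

  AlongPrefix : Fin n → List Dir → Fin n → Set
  AlongPrefix z w l = Σ (List Dir) λ u → u ≼ w × Walk z u l

  visited-along-prefix : ∀ {z w a l} (W : Walk z w a) → l ∈ nodes lab (walkPath W) →
                         AlongPrefix z w l
  visited-along-prefix {w = w} []      (here refl) = [] , (w , refl) , []
  visited-along-prefix {w = w} (e ▸ W) (here refl) = [] , (w , refl) , []
  visited-along-prefix (_▸_ {d = d} e W) (there m) with visited-along-prefix W m
  ... | u , (v , refl) , Wu = d ∷ u , (v , refl) , e ▸ Wu

  visited-split : ∀ {r p z w a l} (Wp : Walk r p z) (Ww : Walk z w a) →
                  l ∈ nodes lab (walkPath (walk-++ Wp Ww)) →
                  l ∈ nodes lab (walkPath Ww) ⊎ Below l z
  visited-split []                Ww m           = inj₁ m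
  visited-split (_▸_ {d = d} e W) Ww (here refl) = inj₂ (d , _ , e ▸ W)
  visited-split (e ▸ W)           Ww (there m)   = visited-split W Ww m

  binder-position : ∀ {z w b l} → Walk z w b → lab b ≡ bvar l →
                    AlongPrefix z w l ⊎ Below l z
  binder-position {z} {b = b} {l} Ww eb with everyReachable z
  ... | r , root , _ , Wp =
    map₁ (visited-along-prefix Ww)
         (visited-split Wp Ww (scoped r b l root eb (walkPath (walk-++ Wp Ww))))

  -- A bound variable is not its own binder, as binders are abstractions.
  not-own-binder : ∀ {v} → lab v ≡ bvar v → ⊥
  not-own-binder {v} e with lab v | e | bindsToAbs v v e
  ... | _ | refl | ()

module Transport {n : ℕ} (G : LambdaGraph n)
                 (R : Rel (Fin n) 0ℓ) (isR : IsSharingEquivalence G R) where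
  open LambdaGraph G
  open AccessPaths G
  open IsSharingEquivalence isR
  module R = IsEquivalence isEquivalence

  step-transport : ∀ {x y d c} → R x y → step (lab x) d ≡ just c →
                   Σ (Fin n) λ c′ → step (lab y) d ≡ just c′ × R c c′
  step-transport {x} {y} {d} r e with lab x in ex | lab y in ey | homogeneous r | d | e
  ... | app a b | app a′ b′ | _ | dL | refl = a′ , refl , proj₁ (appRule ex ey r)
  ... | app a b | app a′ b′ | _ | dR | refl = b′ , refl , proj₂ (appRule ex ey r)
  ... | abs a   | abs a′    | _ | dB | refl = a′ , refl , absRule ex ey r

  walk-transport : ∀ {x y w a} → R x y → Walk x w a → Σ (Fin n) λ b → Walk y w b × R a b
  walk-transport r [] = _ , [] , r
  walk-transport r (e ▸ W) with step-transport r e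
  ... | c′ , e′ , r′ with walk-transport r′ W
  ...   | b , W′ , rb = b , e′ ▸ W′ , rb

  walk-related : ∀ {x y w a b} → R x y → Walk x w a → Walk y w b → R a b
  walk-related r Wx Wy with walk-transport r Wx
  ... | b′ , Wy′ , rb with walk-deterministic Wy Wy′
  ...   | refl = rb

  bvar-transport : ∀ {a b l} → R a b → lab a ≡ bvar l → Σ (Fin n) λ l′ → lab b ≡ bvar l′
  bvar-transport {a} {b} r ea with lab b | trans (sym (cong kind ea)) (homogeneous r)
  ... | bvar l′ | _ = l′ , refl

  -- No node is related to a proper descendant: transporting the descent
  -- along R would give an infinite descending chain.
  unrelated-below : ∀ {u v} → R u v → Below u v → ⊥
  unrelated-below {u} = descend (spo-noetherian below-isStrictPartialOrder u)
    where
    descend : ∀ {u v} → Acc (flip Below) u → R u v → Below u v → ⊥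
    descend (acc down) r (d , k , W) with walk-transport r W
    ... | v′ , W′ , r′ = descend (down (d , k , W)) r′ (d , k , W′)

  related-walk-empty : ∀ {u v k} → R u v → Walk u k v → k ≡ []
  related-walk-empty r []              = refl
  related-walk-empty r (_▸_ {d = d} e W) = ⊥-elim (unrelated-below r (d , _ , e ▸ W))

  prefix-unique : ∀ {y w u₁ u₂ c c′} → u₁ ≼ w → u₂ ≼ w →
                  Walk y u₁ c → Walk y u₂ c′ → R c c′ → u₁ ≡ u₂
  prefix-unique {u₁ = u₁} {u₂} p₁ p₂ W₁ W₂ r with prefixes-comparable p₁ p₂
  ... | inj₁ (k , refl) with walk-++⁻ u₁ W₂
  ...   | c₀ , W₀ , Wk with walk-deterministic W₁ W₀
  ...     | refl with related-walk-empty r Wk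
  ...       | refl = sym (++-identityʳ u₁)
  prefix-unique {u₁ = u₁} {u₂} p₁ p₂ W₁ W₂ r | inj₂ (k , refl) with walk-++⁻ u₂ W₁
  ...   | c₀ , W₀ , Wk with walk-deterministic W₂ W₀
  ...     | refl with related-walk-empty (R.sym r) Wk
  ...       | refl = ++-identityʳ u₂

  binder-transport : ∀ {y z u w l b l′} → R y z → u ≼ w → Walk y u l →
                     Walk z w b → lab b ≡ bvar l′ → R l l′ → Walk z u l′
  binder-transport r pu Wy Wz eb rl with walk-transport r Wy | binder-position Wz eb
  ... | c , Wzc , rc | inj₁ (u′ , pu′ , Wz′) with prefix-unique pu pu′ Wzc Wz′ (R.trans (R.sym rc) rl)
  ...   | refl = Wz′
  binder-transport r pu Wy Wz eb rl | c , Wzc , rc | inj₂ l′↑z =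
    ⊥-elim (unrelated-below (R.trans (R.sym rl) rc) (below-walk l′↑z Wzc))

module Closure {n : ℕ} (G : LambdaGraph n) (Q : Rel (Fin n) 0ℓ) (query : IsQuery G Q)
               (R : Rel (Fin n) 0ℓ) (isR : IsSharingEquivalence G R) (Q⇒R : Q ⇒ R) where
  open LambdaGraph G
  open AccessPaths G
  open Transport G R isR
  open IsSharingEquivalence isR

  S : Rel (Fin n) 0ℓ
  S = _♯ G Q

  ♯⇒R : S ⇒ R
  ♯⇒R (base q)          = Q⇒R q
  ♯⇒R refl♯             = R.refl
  ♯⇒R (sym♯ s)          = R.sym (♯⇒R s)
  ♯⇒R (trans♯ s t)      = R.trans (♯⇒R s) (♯⇒R t)
  ♯⇒R (appL♯ ex ey s)   = proj₁ (appRule ex ey (♯⇒R s))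
  ♯⇒R (appR♯ ex ey s)   = proj₂ (appRule ex ey (♯⇒R s))
  ♯⇒R (abs♯ ex ey s)    = absRule ex ey (♯⇒R s)

  CommonBinder : Fin n → Fin n → List Dir → Fin n → Fin n → Set
  CommonBinder x y w l l′ = Σ (List Dir) λ u → u ≼ w × Walk x u l × Walk y u l′

  BindersMatch : Fin n → Fin n → Set
  BindersMatch x y = ∀ {w a b l l′} → Walk x w a → Walk y w b →
                     lab a ≡ bvar l → lab b ≡ bvar l′ → CommonBinder x y w l l′ ⊎ S l l′

  -- Q relates roots: the binder below the root x sits on the walk from x
  -- (it cannot be above x), and binder-transport moves it to y.
  match-root : ∀ {x y} → IsRoot lab x → R x y → BindersMatch x y
  match-root root r Wx Wy ea eb with binder-position Wx ea
  ... | inj₂ l↑x = ⊥-elim (root-unbelow root l↑x)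
  ... | inj₁ (u , pu , Wxu) =
    inj₁ (u , pu , Wxu , binder-transport r pu Wxu Wy eb (varRule ea eb (walk-related r Wx Wy)))

  match-refl : ∀ {x} → BindersMatch x x
  match-refl Wx Wx′ ea eb with walk-deterministic Wx Wx′
  ... | refl with trans (sym ea) eb
  ...   | refl = inj₂ refl♯

  match-sym : ∀ {x y} → BindersMatch x y → BindersMatch y x
  match-sym m Wy Wx eb ea with m Wx Wy ea eb
  ... | inj₁ (u , pu , Wxu , Wyu) = inj₁ (u , pu , Wyu , Wxu)
  ... | inj₂ s                    = inj₂ (sym♯ s)

  -- Transitivity: follow the word through the intermediate node y.  Two
  -- common prefixes meet at the same binder below y, hence coincide; a common
  -- prefix on one side and related binders on the other are combined by
  -- binder-transport.
  match-trans : ∀ {x y z} → S x y → S y z → BindersMatch x y → BindersMatch y z →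
                BindersMatch x z
  match-trans s t mxy myz Wx Wz ea ec with walk-transport (♯⇒R s) Wx
  ... | b , Wy , rab with bvar-transport rab ea
  ...   | _ , eb with mxy Wx Wy ea eb | myz Wy Wz eb ec
  ...     | inj₁ (u , pu , Wxu , Wyu) | inj₁ (u′ , pu′ , Wyu′ , Wzu′)
            with prefix-unique pu pu′ Wyu Wyu′ R.refl
  ...       | refl = inj₁ (u , pu , Wxu , Wzu′)
  match-trans s t mxy myz Wx Wz ea ec | b , Wy , rab | _ , eb
          | inj₁ (u , pu , Wxu , Wyu) | inj₂ s′ =
    inj₁ (u , pu , Wxu , binder-transport (♯⇒R t) pu Wyu Wz ec (♯⇒R s′))
  match-trans s t mxy myz Wx Wz ea ec | b , Wy , rab | _ , eb
          | inj₂ s′ | inj₁ (u , pu , Wyu , Wzu) =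
    inj₁ (u , pu , binder-transport (R.sym (♯⇒R s)) pu Wyu Wx ea (R.sym (♯⇒R s′)) , Wzu)
  match-trans s t mxy myz Wx Wz ea ec | b , Wy , rab | _ , eb
          | inj₂ s′ | inj₂ t′ = inj₂ (trans♯ s′ t′)

  -- Passing to children in a common direction: a common binder at the empty
  -- prefix is the pair (x, y) itself, which is S-related.
  match-child : ∀ {x y c c′ d} → step (lab x) d ≡ just c → step (lab y) d ≡ just c′ →
                S x y → BindersMatch x y → BindersMatch c c′
  match-child ex ey s m Wc Wc′ ea eb with m (ex ▸ Wc) (ey ▸ Wc′) ea eb
  ... | inj₂ t = inj₂ t
  ... | inj₁ ([] , _ , [] , []) = inj₂ s
  ... | inj₁ (_ ∷ u , (v , refl) , ex′ ▸ W , ey′ ▸ W′)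
          with just-injective (trans (sym ex) ex′) | just-injective (trans (sym ey) ey′)
  ...   | refl | refl = inj₁ (u , (v , refl) , W , W′)

  binders-match : ∀ {x y} → S x y → BindersMatch x y
  binders-match (base q)        = match-root (proj₁ (query _ _ q)) (Q⇒R q)
  binders-match refl♯           = match-refl
  binders-match (sym♯ s)        = match-sym (binders-match s)
  binders-match (trans♯ s t)    = match-trans s t (binders-match s) (binders-match t)
  binders-match (appL♯ ex ey s) =
    match-child (cong (λ t → step t dL) ex) (cong (λ t → step t dL) ey) s (binders-match s)
  binders-match (appR♯ ex ey s) =
    match-child (cong (λ t → step t dR) ex) (cong (λ t → step t dR) ey) s (binders-match s)
  binders-match (abs♯ ex ey s)  =
    match-child (cong (λ t → step t dB) ex) (cong (λ t → step t dB) ey) s (binders-match s)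

  -- The Var rule: with the empty word, a common binder would be x itself.
  ♯-varRule : ∀ {x y l l′} → lab x ≡ bvar l → lab y ≡ bvar l′ → S x y → S l l′
  ♯-varRule ex ey s with binders-match s [] [] ex ey
  ... | inj₂ t                  = t
  ... | inj₁ ([] , _ , [] , _)  = ⊥-elim (not-own-binder ex)

  ♯-isSharingEquivalence : IsSharingEquivalence G S
  ♯-isSharingEquivalence = record
    { isEquivalence = record { refl = refl♯ ; sym = sym♯ ; trans = trans♯ }
    ; homogeneous   = λ s → homogeneous (♯⇒R s)
    ; appRule       = λ ex ey s → appL♯ ex ey s , appR♯ ex ey s
    ; absRule       = abs♯
    ; varRule       = ♯-varRule
    ; open-         = λ ex ey s → open- ex ey (♯⇒R s)
    }

mainTheorem15 : ∀ {n : ℕ} (G : LambdaGraph n) (Q : Rel (Fin n) 0ℓ) → IsQuery G Q →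
    IsSharingEquivalence G (_♯ G Q) ⇔ Σ (Rel (Fin n) 0ℓ) (λ R → IsSharingEquivalence G R × (Q ⇒ R))
mainTheorem15 G Q query = mk⇔
  (λ isSE → _♯ G Q , isSE , λ {x} {y} q → base q)
  (λ { (R , isR , Q⇒R) → Closure.♯-isSharingEquivalence G Q query R isR Q⇒R })
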